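{- Let $f:\{ -1,1\}^n\to\{ -1,1\}$ be a symmetric function with predicate $D_f:\{0,1,\dots,n\}\to\{ -1,1\}$, suppose the odd-even degree of $f$ equals $k$, and suppose $n$ is even. Then $\mathsf{PP}(f\circ\mathsf{XOR})=O(k\log n)$.
   Context: $D_f(i)$ is the value of $f$ on inputs with exactly $i$ coordinates equal to $-1$; the odd-even degree is $|\{i\in\{0,\dots,n-2\}:D_f(i)\ne D_f(i+2)\}|$. $(f\circ\mathsf{XOR})(x,y)=f(x_1y_1,\dots,x_ny_n)$ for $x,y\in\{ -1,1\}^n$, Alice holding $x$ and Bob $y$. $R_\epsilon(G)$ is the minimum cost of a private-coin randomized protocol correct with probability $\ge1/2+\epsilon$ on every input, and $\mathsf{PP}(G)=\min_{\epsilon>0}(R_\epsilon(G)+\log(1/\epsilon))$. -}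

module Defs where

open import Data.Nat using (ℕ; zero; suc; _+_; _*_; _∸_; _^_; _≤_; _<_)
open import Data.Nat.Properties using (_≟_)
open import Data.Fin using (Fin; toℕ)
open import Data.Product using (_×_; _,_; Σ; ∃; ∃₂)
open import Relation.Binary.PropositionalEquality using (_≡_; _≢_)
open import Relation.Nullary using (yes; no)

-- The two values {-1, 1}: pos = +1, neg = -1.
data PM : Set where
  pos neg : PM

_·_ : PM → PM → PM
pos · b = b
neg · pos = neg
neg · neg = pos

pmEq : PM → PM → ℕ
pmEq pos pos = 1
pmEq neg neg = 1
pmEq _ _ = 0

sumFin : ∀ {m} → (Fin m → ℕ) → ℕ
sumFin {zero} g = 0
sumFin {suc m} g = g Fin.zero + sumFin (λ i → g (Fin.suc i))

countNeg : ∀ {n} → (Fin n → PM) → ℕ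
countNeg x = sumFin (λ i → isNeg (x i))
  where
  isNeg : PM → ℕ
  isNeg pos = 0
  isNeg neg = 1

Symmetric : ∀ {n} → ((Fin n → PM) → PM) → Set
Symmetric {n} f = ∀ (x y : Fin n → PM) → countNeg x ≡ countNeg y → f x ≡ f y

stdInput : ∀ n → ℕ → Fin n → PM
stdInput n i j with suc (toℕ j) Data.Nat.≤? i
... | yes _ = neg
... | no _ = pos

-- predicate D_f(i) (meaningful for symmetric f and i ≤ n)
D : ∀ {n} → ((Fin n → PM) → PM) → ℕ → PM
D {n} f i = f (stdInput n i)

pmNeq : PM → PM → ℕ
pmNeq pos neg = 1
pmNeq neg pos = 1
pmNeq _ _ = 0

sumBelow : ℕ → (ℕ → ℕ) → ℕ
sumBelow zero g = 0
sumBelow (suc m) g = sumBelow m g + g m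

oddEvenDeg : ∀ {n} → ((Fin n → PM) → PM) → ℕ
oddEvenDeg {n} f = sumBelow (n ∸ 1) (λ i → pmNeq (D f i) (D f (2 + i)))

_∘XOR : ∀ {n} → ((Fin n → PM) → PM) → (Fin n → PM) → (Fin n → PM) → PM
(f ∘XOR) x y = f (λ i → x i · y i)

-- Deterministic two-party protocol trees communicating at most c bits;
-- Alice sees X, Bob sees Y; leaves output a ±1 value.
data Protocol (X Y : Set) : ℕ → Set where
  leaf  : ∀ {c} → PM → Protocol X Y c
  alice : ∀ {c} → (X → PM) → (PM → Protocol X Y c) → Protocol X Y (suc c)
  bob   : ∀ {c} → (Y → PM) → (PM → Protocol X Y c) → Protocol X Y (suc c)

run : ∀ {X Y c} → Protocol X Y c → X → Y → PM
run (leaf o) x y = o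
run (alice m k) x y = run (k (m x)) x y
run (bob m k) x y = run (k (m y)) x y

-- A private-coin randomized protocol of cost ≤ c: Alice's private randomness
-- is uniform on Fin (suc a), Bob's uniform on Fin (suc b), independent.
record RandProtocol (X Y : Set) (c : ℕ) : Set where
  field
    a b : ℕ
    tree : Protocol (X × Fin (suc a)) (Y × Fin (suc b)) c

open RandProtocol public

numCorrect : ∀ {X Y c} → RandProtocol X Y c → (X → Y → PM) → X → Y → ℕ
numCorrect P G x y =
  sumFin (λ ra → sumFin (λ rb → pmEq (run (tree P) (x , ra) (y , rb)) (G x y)))

-- P computes G with success probability ≥ 1/2 + 1/2^t on every input, i.e.
-- numCorrect / ((a+1)(b+1)) ≥ 1/2 + 1/2^t, cleared of denominators.
CorrectWithBias : ∀ {X Y c} → RandProtocol X Y c → (X → Y → PM) → ℕ → Set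
CorrectWithBias {X} {Y} P G t =
  ∀ (x : X) (y : Y) →
    (2 ^ t + 2) * (suc (a P) * suc (b P)) ≤ 2 ^ (suc t) * numCorrect P G x y

-- "PP(G) ≤ B" : some protocol of cost c with bias ε = 2^-t has c + log(1/ε) = c + t ≤ B.
PPAtMost : ∀ {X Y : Set} → (X → Y → PM) → ℕ → Set
PPAtMost {X} {Y} G B =
  ∃₂ λ (c t : ℕ) → (c + t ≤ B) × Σ (RandProtocol X Y c) (λ P → CorrectWithBias P G t)

module Submission where

-- Write z = x · y and d = |z|, the number of -1's in z, so (f ∘ XOR) x y = D f d.
-- Telescoping along indices of the parity of d gives
--   D f d · D f (base (psign d)) = ∏ over roots i < d, i ≡ d (mod 2), of -1,
-- where the roots are the k indices i with D f i ≠ D f (i + 2).  Each factor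
-- "is i < d?" is estimated by a ±1 value read at a uniform sample among 2n
-- positions, whose signed sum over all samples is 2 (i + 1) - 2 d.  Alice sends the parity of x
-- (so Bob knows psign d) and one independent sample per root, each in
-- ⌈log₂ n ⌉ + 2 bits; Bob outputs D f (base (psign d)) times the product of
-- the k estimates.  Its expectation has the sign of f z and magnitude at least
-- (2n)^-k, so cost + log (1/bias) = O(k log n).

open import Defs
open import Data.Nat
  using (ℕ; NonZero; >-nonZero; pred; zero; suc; _+_; _*_; _∸_; _^_; _≤_; _<_; z≤n; s≤s; s≤s⁻¹; _≤?_; _<?_; ⌊_/2⌋; ⌈_/2⌉)
open import Data.Nat.Divisibility using (_∣_)
open import Data.Nat.Induction using (<-rec)
open import Data.Nat.Logarithm using (⌈log₂_⌉; ⌈log₂⌉-mono-≤; ⌈log₂2^n⌉≡n; ⌈log₂⌈n/2⌉⌉≡⌈log₂n⌉∸1)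
import Data.Nat.Properties as ℕP
open import Data.Integer.Base as ℤ using (ℤ; +_; +[1+_]; -1ℤ)
import Data.Integer.Properties as ℤP
open import Data.Integer.Tactic.RingSolver using (solve-∀)
import Data.Nat.Tactic.RingSolver as ℕSolver
open import Data.Fin using (Fin; toℕ; _↑ˡ_; _↑ʳ_; splitAt; combine; remQuot; inject≤; fromℕ<)
import Data.Fin.Properties as FinP
open import Data.Product using (∃; _×_; _,_; proj₁; proj₂; uncurry)
open import Data.Vec as Vec using (Vec; []; _∷_)
import Data.Vec.Properties as VecP
open import Data.Sum using (_⊎_; inj₁; inj₂)
open import Data.List using (List; []; _∷_; length)
open import Function using (_∘_)
open import Relation.Nullary using (¬_; Dec; yes; no; contradiction)
open import Relation.Binary.PropositionalEquality
open import Algebra.Properties.Semiring.Sum ℤP.+-*-semiring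
  using (sum; sum-cong-≗; *-distribˡ-sum; *-distribʳ-sum)

val : PM → ℤ
val pos = + 1
val neg = -1ℤ

val-· : ∀ a b → val (a · b) ≡ val a ℤ.* val b
val-· pos pos = refl
val-· pos neg = refl
val-· neg pos = refl
val-· neg neg = refl

·-comm : ∀ a b → a · b ≡ b · a
·-comm pos pos = refl
·-comm pos neg = refl
·-comm neg pos = refl
·-comm neg neg = refl

·-assoc : ∀ a b c → (a · b) · c ≡ a · (b · c)
·-assoc pos b c = refl
·-assoc neg pos c = refl
·-assoc neg neg pos = refl
·-assoc neg neg neg = refl

·-identityʳ : ∀ a → a · pos ≡ a
·-identityʳ pos = refl
·-identityʳ neg = refl

·-self : ∀ a → a · a ≡ pos
·-self pos = refl
·-self neg = refl

·-interchange : ∀ a b c d → (a · b) · (c · d) ≡ (a · c) · (b · d)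
·-interchange a b c d = begin
  (a · b) · (c · d)  ≡⟨ ·-assoc a b (c · d) ⟩
  a · (b · (c · d))  ≡⟨ cong (a ·_) (sym (·-assoc b c d)) ⟩
  a · ((b · c) · d)  ≡⟨ cong (λ u → a · (u · d)) (·-comm b c) ⟩
  a · ((c · b) · d)  ≡⟨ cong (a ·_) (·-assoc c b d) ⟩
  a · (c · (b · d))  ≡⟨ sym (·-assoc a c (b · d)) ⟩
  (a · c) · (b · d)  ∎
  where open ≡-Reasoning

_≟±_ : (p q : PM) → Dec (p ≡ q)
pos ≟± pos = yes refl
pos ≟± neg = no (λ ())
neg ≟± pos = no (λ ())
neg ≟± neg = yes refl

p≢neg·p : ∀ p → p ≢ neg · p
p≢neg·p pos ()
p≢neg·p neg ()

sum-↑ : ∀ m n (h : Fin (m + n) → ℤ) →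
  sum h ≡ sum (λ i → h (i ↑ˡ n)) ℤ.+ sum (λ j → h (m ↑ʳ j))
sum-↑ zero    n h = sym (ℤP.+-identityˡ _)
sum-↑ (suc m) n h =
  trans (cong (λ s → h Fin.zero ℤ.+ s) (sum-↑ m n (h ∘ Fin.suc))) (sym (ℤP.+-assoc (h Fin.zero) _ _))

sum-splitAt : ∀ m n (h : Fin m ⊎ Fin n → ℤ) →
  sum (λ ω → h (splitAt m ω)) ≡ sum (h ∘ inj₁) ℤ.+ sum (h ∘ inj₂)
sum-splitAt m n h = trans (sum-↑ m n (h ∘ splitAt m))
  (cong₂ ℤ._+_ (sum-cong-≗ (λ i → cong h (FinP.splitAt-↑ˡ m i n)))
               (sum-cong-≗ (λ j → cong h (FinP.splitAt-↑ʳ m n j))))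

sum-combine : ∀ m k (h : Fin (m * k) → ℤ) → sum h ≡ sum {m} (λ a → sum {k} (λ b → h (combine a b)))
sum-combine zero    k h = refl
sum-combine (suc m) k h =
  trans (sum-↑ k (m * k) h) (cong (λ s → sum (λ b → h (b ↑ˡ (m * k))) ℤ.+ s) (sum-combine m k (h ∘ (k ↑ʳ_))))

sum-remQuot : ∀ m k (h : Fin m × Fin k → ℤ) →
  sum (λ ω → h (remQuot {m} k ω)) ≡ sum (λ a → sum (λ b → h (a , b)))
sum-remQuot m k h = trans (sum-combine m k (h ∘ remQuot {m} k))
  (sum-cong-≗ (λ a → sum-cong-≗ (λ b → cong h (FinP.remQuot-combine a b))))

sum-subst : ∀ {m m'} (e : m ≡ m') (h : Fin m' → ℤ) → sum (h ∘ subst Fin e) ≡ sum h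
sum-subst refl h = refl

sum-product : ∀ {m k} (u : Fin m → ℤ) (v : Fin k → ℤ) →
  sum (λ a → sum (λ b → u a ℤ.* v b)) ≡ sum u ℤ.* sum v
sum-product u v = trans (sum-cong-≗ (λ a → sym (*-distribˡ-sum (u a) v)))
                        (sym (*-distribʳ-sum (sum v) u))

sum-ones : ∀ m → sum {m} (λ _ → + 1) ≡ + m
sum-ones zero    = refl
sum-ones (suc m) = cong (λ s → + 1 ℤ.+ s) (sum-ones m)

prodℤ : List ℕ → (ℕ → ℤ) → ℤ
prodℤ []      F = + 1
prodℤ (i ∷ R) F = F i ℤ.* prodℤ R F

record HasSign (p : PM) (z : ℤ) : Set where
  constructor hasSign
  field
    pred∣z∣  : ℕ
    signed-z : val p ℤ.* z ≡ +[1+ pred∣z∣ ]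

HasSign-· : ∀ {p q a b} → HasSign p a → HasSign q b → HasSign (p · q) (a ℤ.* b)
HasSign-· {p} {q} {a} {b} (hasSign k pa≡) (hasSign l qb≡) = hasSign (l + k * suc l) (begin
  val (p · q) ℤ.* (a ℤ.* b)            ≡⟨ cong (ℤ._* (a ℤ.* b)) (val-· p q) ⟩
  (val p ℤ.* val q) ℤ.* (a ℤ.* b)      ≡⟨ interchange (val p) (val q) a b ⟩
  (val p ℤ.* a) ℤ.* (val q ℤ.* b)      ≡⟨ cong₂ ℤ._*_ pa≡ qb≡ ⟩
  +[1+ k ] ℤ.* +[1+ l ]                ∎)
  where
  open ≡-Reasoning
  interchange : ∀ w x y z → (w ℤ.* x) ℤ.* (y ℤ.* z) ≡ (w ℤ.* y) ℤ.* (x ℤ.* z)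
  interchange = solve-∀

HasSign-factor : ∀ {p q z} → HasSign (p · q) z → HasSign p (val q ℤ.* z)
HasSign-factor {p} {q} {z} (hasSign k signed) =
  hasSign k (trans (sym (ℤP.*-assoc (val p) (val q) z)) (trans (cong (ℤ._* z) (sym (val-· p q))) signed))

HasSign-resign : ∀ {p q z} → p ≡ q → HasSign p z → HasSign q z
HasSign-resign refl s = s

twice-gap : ∀ {a b} → a < b → HasSign pos (+ 2 ℤ.* + b ℤ.- + 2 ℤ.* + a)
twice-gap {a} {b} a<b rewrite sym (ℕP.m+[n∸m]≡n a<b) =
  hasSign _ (trans (ℤP.*-identityˡ _) (gap (+ a) (+ (b ∸ suc a))))
  where
  gap : ∀ A C → + 2 ℤ.* (+ 1 ℤ.+ (A ℤ.+ C)) ℤ.- + 2 ℤ.* A ≡ + 2 ℤ.* (+ 1 ℤ.+ C)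
  gap = solve-∀

twice-gap⁻ : ∀ {a b} → a < b → HasSign neg (+ 2 ℤ.* + a ℤ.- + 2 ℤ.* + b)
twice-gap⁻ {a} {b} a<b with twice-gap a<b
... | hasSign k e = hasSign k (trans (negate (+ a) (+ b)) e)
  where
  negate : ∀ A B → -1ℤ ℤ.* (+ 2 ℤ.* A ℤ.- + 2 ℤ.* B) ≡ + 1 ℤ.* (+ 2 ℤ.* B ℤ.- + 2 ℤ.* A)
  negate = solve-∀

HasSign-pos : ∀ m → HasSign pos (+ suc m)
HasSign-pos m = hasSign m (ℤP.*-identityˡ _)

countNeg≤ : ∀ {m} (x : Fin m → PM) → countNeg x ≤ m
countNeg≤ {zero}  x = z≤n
countNeg≤ {suc m} x with x Fin.zero
... | pos = ℕP.m≤n⇒m≤1+n (countNeg≤ (x ∘ Fin.suc))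
... | neg = s≤s (countNeg≤ (x ∘ Fin.suc))

countNeg-cong : ∀ {m} {x y : Fin m → PM} → (∀ i → x i ≡ y i) → countNeg x ≡ countNeg y
countNeg-cong {zero}  e = refl
countNeg-cong {suc m} {x} {y} e with x Fin.zero | y Fin.zero | e Fin.zero
... | pos | .pos | refl = countNeg-cong (e ∘ Fin.suc)
... | neg | .neg | refl = cong suc (countNeg-cong (e ∘ Fin.suc))

sum-val : ∀ {m} (z : Fin m → PM) → sum (val ∘ z) ≡ + m ℤ.- + 2 ℤ.* + countNeg z
sum-val {zero}  z = refl
sum-val {suc m} z with z Fin.zero
... | pos = trans (cong (λ s → + 1 ℤ.+ s) (sum-val (z ∘ Fin.suc))) (shift (+ m) (+ countNeg (z ∘ Fin.suc)))
  where
  shift : ∀ a c → + 1 ℤ.+ (a ℤ.- + 2 ℤ.* c) ≡ (+ 1 ℤ.+ a) ℤ.- + 2 ℤ.* c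
  shift = solve-∀
... | neg = trans (cong (λ s → -1ℤ ℤ.+ s) (sum-val (z ∘ Fin.suc))) (shift (+ m) (+ countNeg (z ∘ Fin.suc)))
  where
  shift : ∀ a c → -1ℤ ℤ.+ (a ℤ.- + 2 ℤ.* c) ≡ (+ 1 ℤ.+ a) ℤ.- + 2 ℤ.* (+ 1 ℤ.+ c)
  shift = solve-∀

stdInput-< : ∀ n i (j : Fin n) → toℕ j < i → stdInput n i j ≡ neg
stdInput-< n i j j<i with suc (toℕ j) ≤? i
... | yes _   = refl
... | no j≮i = contradiction j<i j≮i

stdInput-≮ : ∀ n i (j : Fin n) → ¬ toℕ j < i → stdInput n i j ≡ pos
stdInput-≮ n i j j≮i with suc (toℕ j) ≤? i
... | yes j<i = contradiction j<i j≮i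
... | no _    = refl

stdInput-suc : ∀ n i (j : Fin n) → stdInput (suc n) (suc i) (Fin.suc j) ≡ stdInput n i j
stdInput-suc n i j = byCases (toℕ j <? i)
  where
  byCases : Dec (toℕ j < i) → stdInput (suc n) (suc i) (Fin.suc j) ≡ stdInput n i j
  byCases (yes j<i) = trans (stdInput-< (suc n) (suc i) (Fin.suc j) (s≤s j<i)) (sym (stdInput-< n i j j<i))
  byCases (no j≮i)  = trans (stdInput-≮ (suc n) (suc i) (Fin.suc j) (j≮i ∘ s≤s⁻¹)) (sym (stdInput-≮ n i j j≮i))

-- stdInput n i has exactly i coordinates equal to -1 (for i ≤ n), so D f i is
-- the value of a symmetric f on inputs with i coordinates equal to -1.
countNeg-stdInput : ∀ n i → i ≤ n → countNeg (stdInput n i) ≡ i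
countNeg-stdInput n       zero    _ =
  trans (countNeg-cong {y = λ _ → pos} (λ j → stdInput-≮ n 0 j (λ ()))) (allPos n)
  where
  allPos : ∀ m → countNeg {m} (λ _ → pos) ≡ 0
  allPos zero    = refl
  allPos (suc m) = allPos m
countNeg-stdInput (suc n) (suc i) (s≤s i≤n) =
  cong suc (trans (countNeg-cong (stdInput-suc n i)) (countNeg-stdInput n i i≤n))

psign : ℕ → PM
psign zero          = pos
psign (suc zero)    = neg
psign (suc (suc d)) = psign d

psign-suc : ∀ d → psign (suc d) ≡ neg · psign d
psign-suc zero          = refl
psign-suc (suc zero)    = refl
psign-suc (suc (suc d)) = psign-suc d

-- The least natural number with parity sign p.
base : PM → ℕ
base pos = 0
base neg = 1

prodPM : ∀ {m} → (Fin m → PM) → PM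
prodPM {zero}  x = pos
prodPM {suc m} x = x Fin.zero · prodPM (x ∘ Fin.suc)

prodPM-countNeg : ∀ {m} (x : Fin m → PM) → prodPM x ≡ psign (countNeg x)
prodPM-countNeg {zero}  x = refl
prodPM-countNeg {suc m} x with x Fin.zero
... | pos = prodPM-countNeg (x ∘ Fin.suc)
... | neg = trans (cong (neg ·_) (prodPM-countNeg (x ∘ Fin.suc))) (sym (psign-suc (countNeg (x ∘ Fin.suc))))

-- The product of the coordinates of x · y factorises: Bob learns the parity of
-- x · y from Alice's single bit prodPM x.
prodPM-· : ∀ {m} (x y : Fin m → PM) → prodPM (λ i → x i · y i) ≡ prodPM x · prodPM y
prodPM-· {zero}  x y = refl
prodPM-· {suc m} x y =
  trans (cong ((x Fin.zero · y Fin.zero) ·_) (prodPM-· (x ∘ Fin.suc) (y ∘ Fin.suc)))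
        (·-interchange (x Fin.zero) (y Fin.zero) _ _)

whenEq : PM → PM → PM → PM
whenEq pos pos w = w
whenEq neg neg w = w
whenEq pos neg w = pos
whenEq neg pos w = pos

whenEq-≡ : ∀ {p q} w → p ≡ q → whenEq p q w ≡ w
whenEq-≡ {pos} w refl = refl
whenEq-≡ {neg} w refl = refl

whenEq-≢ : ∀ p q w → p ≢ q → whenEq p q w ≡ pos
whenEq-≢ pos pos w p≢q = contradiction refl p≢q
whenEq-≢ pos neg w p≢q = refl
whenEq-≢ neg pos w p≢q = refl
whenEq-≢ neg neg w p≢q = contradiction refl p≢q

whenEq-pos : ∀ p q → whenEq p q pos ≡ pos
whenEq-pos pos pos = refl
whenEq-pos pos neg = refl
whenEq-pos neg pos = refl
whenEq-pos neg neg = refl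

below : ℕ → ℕ → PM → PM
below m d w with m <? d
... | yes _ = w
... | no _  = pos

below-< : ∀ {m d} w → m < d → below m d w ≡ w
below-< {m} {d} w m<d with m <? d
... | yes _   = refl
... | no m≮d = contradiction m<d m≮d

below-≮ : ∀ {m d} w → ¬ m < d → below m d w ≡ pos
below-≮ {m} {d} w m≮d with m <? d
... | yes m<d = contradiction m<d m≮d
... | no _    = refl

below-pos : ∀ m d → below m d pos ≡ pos
below-pos m d with m <? d
... | yes _ = refl
... | no _  = refl

-- mask m d w is w when m < d and m, d have the same parity, and +1 otherwise;
-- it selects the factors of the telescoping product below.
mask : ℕ → ℕ → PM → PM
mask m d w = whenEq (psign m) (psign d) (below m d w)

mask-pos : ∀ m d → mask m d pos ≡ pos
mask-pos m d = trans (cong (whenEq (psign m) (psign d)) (below-pos m d)) (whenEq-pos (psign m) (psign d))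

mask-vanish : ∀ {m d} w → d ≤ suc m → mask m d w ≡ pos
mask-vanish {m} {d} w d≤1+m with ℕP.m≤n⇒m<n∨m≡n d≤1+m
... | inj₁ (s≤s d≤m) = trans (cong (whenEq (psign m) (psign d)) (below-≮ w (ℕP.≤⇒≯ d≤m)))
                             (whenEq-pos (psign m) (psign d))
... | inj₂ refl      = trans (cong (λ q → whenEq (psign m) q (below m d w)) (psign-suc m))
                             (whenEq-≢ (psign m) (neg · psign m) _ (p≢neg·p (psign m)))

mask-shift : ∀ {m d} w → m < d → mask m (2 + d) w ≡ mask m d w
mask-shift {m} {d} w m<d = cong (whenEq (psign m) (psign d))
  (trans (below-< w (ℕP.m≤n⇒m≤o+n 2 m<d)) (sym (below-< w m<d)))

mask-top : ∀ d w → mask d (2 + d) w ≡ w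
mask-top d w = trans (whenEq-≡ (below d (2 + d) w) refl) (below-< w (ℕP.m≤n+m (suc d) 1))

parity-gap : ∀ {i d} → i < d → psign i ≡ psign d → suc i < d
parity-gap {i} i<d i≡d with ℕP.m≤n⇒m<n∨m≡n i<d
... | inj₁ 1+i<d = 1+i<d
... | inj₂ refl  = contradiction (trans i≡d (psign-suc i)) (p≢neg·p (psign i))

addRoot : PM → PM → ℕ → List ℕ → List ℕ
addRoot pos pos i R = R
addRoot neg neg i R = R
addRoot pos neg i R = i ∷ R
addRoot neg pos i R = i ∷ R

length-addRoot : ∀ a b i R → length (addRoot a b i R) ≡ length R + pmNeq a b
length-addRoot pos pos i R = sym (ℕP.+-identityʳ (length R))
length-addRoot neg neg i R = sym (ℕP.+-identityʳ (length R))
length-addRoot pos neg i R = ℕP.+-comm 1 (length R)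
length-addRoot neg pos i R = ℕP.+-comm 1 (length R)

-- Independent sampling: a uniform ω ∈ Fin (m ^ length R) gives one independent
-- uniform sample in Fin m for each entry i of R, fed to the experiment e i.
sampleAll : ∀ {m} (R : List ℕ) → (ℕ → Fin m → PM) → Fin (m ^ length R) → PM
sampleAll         []      e ω = pos
sampleAll {m} (i ∷ R) e ω = e i (proj₁ q) · sampleAll R e (proj₂ q)
  where q = remQuot {m} (m ^ length R) ω

sum-sampleAll : ∀ {m} (R : List ℕ) (e : ℕ → Fin m → PM) →
  sum (val ∘ sampleAll R e) ≡ prodℤ R (λ i → sum (val ∘ e i))
sum-sampleAll         []      e = refl
sum-sampleAll {m} (i ∷ R) e = begin
  sum (val ∘ sampleAll (i ∷ R) e)
    ≡⟨ sum-remQuot m (m ^ length R) (λ (a , b) → val (e i a · sampleAll R e b)) ⟩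
  sum (λ a → sum (λ b → val (e i a · sampleAll R e b)))
    ≡⟨ sum-cong-≗ (λ a → sum-cong-≗ (λ b → val-· (e i a) (sampleAll R e b))) ⟩
  sum (λ a → sum (λ b → val (e i a) ℤ.* val (sampleAll R e b)))
    ≡⟨ sum-product (val ∘ e i) (val ∘ sampleAll R e) ⟩
  sum (val ∘ e i) ℤ.* sum (val ∘ sampleAll R e)
    ≡⟨ cong (sum (val ∘ e i) ℤ.*_) (sum-sampleAll R e) ⟩
  prodℤ (i ∷ R) (λ i → sum (val ∘ e i)) ∎
  where open ≡-Reasoning

module Telescope (Dv : ℕ → PM) where

  jump : ℕ → PM
  jump m = Dv m · Dv (2 + m)

  telescope : ℕ → ℕ → PM
  telescope zero    d = pos
  telescope (suc N) d = telescope N d · mask N d (jump N)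

  telescope-extend : ∀ N d → d ≤ suc N → telescope (suc N) d ≡ telescope N d
  telescope-extend N d d≤1+N =
    trans (cong (telescope N d ·_) (mask-vanish (jump N) d≤1+N)) (·-identityʳ _)

  telescope-shift : ∀ N d → N ≤ d → telescope N (2 + d) ≡ telescope N d
  telescope-shift zero    d _   = refl
  telescope-shift (suc N) d N<d =
    cong₂ _·_ (telescope-shift N d (ℕP.<⇒≤ N<d)) (mask-shift (jump N) N<d)

  telescope-diag : ∀ d → telescope d d ≡ Dv d · Dv (base (psign d))
  telescope-diag zero          = sym (·-self (Dv 0))
  telescope-diag (suc zero)    = sym (·-self (Dv 1))
  telescope-diag (suc (suc e)) = begin
    telescope (2 + e) (2 + e)                      ≡⟨ telescope-extend (suc e) (2 + e) ℕP.≤-refl ⟩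
    telescope e (2 + e) · mask e (2 + e) (jump e)  ≡⟨ cong₂ _·_ (telescope-shift e e ℕP.≤-refl) (mask-top e (jump e)) ⟩
    telescope e e · (Dv e · Dv (2 + e))            ≡⟨ cong (_· jump e) (telescope-diag e) ⟩
    (Dv e · Dv e₀) · (Dv e · Dv (2 + e))           ≡⟨ ·-interchange (Dv e) (Dv e₀) (Dv e) (Dv (2 + e)) ⟩
    (Dv e · Dv e) · (Dv e₀ · Dv (2 + e))           ≡⟨ cong (_· (Dv e₀ · Dv (2 + e))) (·-self (Dv e)) ⟩
    Dv e₀ · Dv (2 + e)                             ≡⟨ ·-comm (Dv e₀) (Dv (2 + e)) ⟩
    Dv (2 + e) · Dv e₀                             ∎
    where
    open ≡-Reasoning
    e₀ : ℕ
    e₀ = base (psign e)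

  telescope-settled : ∀ N d → d ≤ suc N → telescope N d ≡ Dv d · Dv (base (psign d))
  telescope-settled N d d≤1+N with ℕP.m≤n⇒m<n∨m≡n d≤1+N
  ... | inj₂ refl = trans (sym (telescope-extend N d ℕP.≤-refl)) (telescope-diag d)
  telescope-settled zero    zero _ | inj₁ _ = telescope-diag zero
  telescope-settled zero (suc d) _ | inj₁ (s≤s ())
  telescope-settled (suc N) d    _ | inj₁ (s≤s d≤1+N) =
    trans (telescope-extend N d d≤1+N) (telescope-settled N d d≤1+N)

  roots : ℕ → List ℕ
  roots zero    = []
  roots (suc N) = addRoot (Dv N) (Dv (2 + N)) N (roots N)

  length-roots : ∀ N → length (roots N) ≡ sumBelow N (λ i → pmNeq (Dv i) (Dv (2 + i)))
  length-roots zero    = refl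
  length-roots (suc N) =
    trans (length-addRoot (Dv N) (Dv (2 + N)) N (roots N)) (cong (_+ pmNeq (Dv N) (Dv (2 + N))) (length-roots N))

  telescope-skip : ∀ N d → telescope N d · mask N d pos ≡ telescope N d
  telescope-skip N d = trans (cong (telescope N d ·_) (mask-pos N d)) (·-identityʳ (telescope N d))

  roots-sign : ∀ N d (F : ℕ → ℤ) → (∀ i → i < N → HasSign (mask i d neg) (F i)) →
    HasSign (telescope N d) (prodℤ (roots N) F)
  roots-sign zero    d F sF = hasSign 0 refl
  roots-sign (suc N) d F sF with Dv N | Dv (2 + N) | roots-sign N d F (λ i i<N → sF i (ℕP.m≤n⇒m≤1+n i<N))
  ... | pos | pos | s = HasSign-resign (sym (telescope-skip N d)) s
  ... | neg | neg | s = HasSign-resign (sym (telescope-skip N d)) s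
  ... | pos | neg | s = HasSign-resign (·-comm (mask N d neg) (telescope N d)) (HasSign-· (sF N ℕP.≤-refl) s)
  ... | neg | pos | s = HasSign-resign (·-comm (mask N d neg) (telescope N d)) (HasSign-· (sF N ℕP.≤-refl) s)

-- A uniform sample ω ∈ Fin (n + n) reads either a
-- coordinate z r or the negated coordinate of stdInput n (i + 1); the signed sum
-- over all samples is 2 (i + 1) - 2 |z|, whose sign is -1 exactly when i < |z|
-- (for i of the parity of |z|).  Given P = psign |z|, samples at a root of the
-- other parity are constantly +1.

module Estimator (n : ℕ) where

  rawSample : ℕ → (Fin n → PM) → Fin n ⊎ Fin n → PM
  rawSample i z (inj₁ r) = z r
  rawSample i z (inj₂ r) = neg · stdInput n (suc i) r

  estimate : ℕ → PM → (Fin n → PM) → Fin (n + n) → PM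
  estimate i P z ω = whenEq (psign i) P (rawSample i z (splitAt n ω))

  rawSample-sum : ∀ i z → suc i ≤ n →
    sum (λ ω → val (rawSample i z (splitAt n ω))) ≡ + 2 ℤ.* + suc i ℤ.- + 2 ℤ.* + countNeg z
  rawSample-sum i z i<n = begin
    sum (λ ω → val (rawSample i z (splitAt n ω)))
      ≡⟨ sum-splitAt n n (val ∘ rawSample i z) ⟩
    sum (val ∘ z) ℤ.+ sum (λ r → val (neg · s r))
      ≡⟨ cong (λ t → sum (val ∘ z) ℤ.+ t) (trans (sum-cong-≗ (λ r → val-· neg (s r))) (sym (*-distribˡ-sum -1ℤ (val ∘ s)))) ⟩
    sum (val ∘ z) ℤ.+ -1ℤ ℤ.* sum (val ∘ s)
      ≡⟨ cong₂ (λ a b → a ℤ.+ -1ℤ ℤ.* b) (sum-val z) sum-s ⟩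
    (+ n ℤ.- + 2 ℤ.* + countNeg z) ℤ.+ -1ℤ ℤ.* (+ n ℤ.- + 2 ℤ.* + suc i)
      ≡⟨ cancel (+ n) (+ countNeg z) (+ suc i) ⟩
    + 2 ℤ.* + suc i ℤ.- + 2 ℤ.* + countNeg z ∎
    where
    open ≡-Reasoning
    s = stdInput n (suc i)
    sum-s : sum (val ∘ s) ≡ + n ℤ.- + 2 ℤ.* + suc i
    sum-s = trans (sum-val s) (cong (λ c → + n ℤ.- + 2 ℤ.* + c) (countNeg-stdInput n (suc i) i<n))
    cancel : ∀ N D S → (N ℤ.- + 2 ℤ.* D) ℤ.+ -1ℤ ℤ.* (N ℤ.- + 2 ℤ.* S) ≡ + 2 ℤ.* S ℤ.- + 2 ℤ.* D
    cancel = solve-∀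

  estimate-sign : ∀ i z → suc i ≤ n →
    HasSign (mask i (countNeg z) neg) (sum (λ ω → val (estimate i (psign (countNeg z)) z ω)))
  estimate-sign i z i<n with psign i ≟± psign (countNeg z)
  ... | no i≢d = HasSign-resign (sym (whenEq-≢ _ _ (below i (countNeg z) neg) i≢d))
                   (subst (HasSign pos) (sym constant) (twoCopies i<n))
    where
    constant : sum (λ ω → val (estimate i (psign (countNeg z)) z ω)) ≡ + (n + n)
    constant = trans (sum-cong-≗ (λ ω → cong val (whenEq-≢ _ _ (rawSample i z (splitAt n ω)) i≢d)))
                     (sum-ones (n + n))
    twoCopies : suc i ≤ n → HasSign pos (+ (n + n))
    twoCopies (s≤s {n = m} _) = HasSign-pos (m + suc m)
  ... | yes i≡d = HasSign-resign (sym (whenEq-≡ (below i d neg) i≡d))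
                    (subst (HasSign (below i d neg)) (sym raw) (byComparison (i <? d)))
    where
    d = countNeg z
    raw : sum (λ ω → val (estimate i (psign d) z ω)) ≡ + 2 ℤ.* + suc i ℤ.- + 2 ℤ.* + d
    raw = trans (sum-cong-≗ (λ ω → cong val (whenEq-≡ (rawSample i z (splitAt n ω)) i≡d))) (rawSample-sum i z i<n)
    byComparison : Dec (i < d) → HasSign (below i d neg) (+ 2 ℤ.* + suc i ℤ.- + 2 ℤ.* + d)
    byComparison (yes i<d) = HasSign-resign (sym (below-< neg i<d)) (twice-gap⁻ (parity-gap i<d i≡d))
    byComparison (no i≮d)  = HasSign-resign (sym (below-≮ neg i≮d)) (twice-gap (s≤s (ℕP.≮⇒≥ i≮d)))

record Encoding (M : Set) (m : ℕ) : Set where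
  field
    encode        : M → Vec PM m
    decode        : Vec PM m → M
    decode-encode : ∀ x → decode (encode x) ≡ x

open Encoding

encodePM : Encoding PM 1
encodePM = record
  { encode = λ p → p ∷ []
  ; decode = Vec.head
  ; decode-encode = λ p → refl }

retract : ∀ {A B : Set} {m} (f : A → B) (g : B → A) → (∀ a → g (f a) ≡ a) →
  Encoding B m → Encoding A m
retract f g g∘f E = record
  { encode = encode E ∘ f
  ; decode = g ∘ decode E
  ; decode-encode = λ a → trans (cong g (decode-encode E (f a))) (g∘f a) }

_⊗_ : ∀ {A B : Set} {a b} → Encoding A a → Encoding B b → Encoding (A × B) (a + b)
_⊗_ {A} {B} {a} {b} E F = record { encode = pair ; decode = unpair ; decode-encode = unpair-pair }
  where
  pair : A × B → Vec PM (a + b)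
  pair (x , y) = encode E x Vec.++ encode F y
  unpair : Vec PM (a + b) → A × B
  unpair v with Vec.splitAt a v
  ... | u , w , _ = decode E u , decode F w
  unpair-pair : ∀ xy → unpair (pair xy) ≡ xy
  unpair-pair (x , y) with Vec.splitAt a (encode E x Vec.++ encode F y)
  ... | u , w , eq with VecP.++-injective (encode E x) u eq
  ... | refl , refl = cong₂ _,_ (decode-encode E x) (decode-encode F y)

encodeVec : ∀ {A : Set} {a} → Encoding A a → ∀ K → Encoding (Vec A K) (K * a)
encodeVec E zero    = record { encode = λ _ → [] ; decode = λ _ → [] ; decode-encode = λ { [] → refl } }
encodeVec E (suc K) = retract (λ v → Vec.head v , Vec.tail v) (λ (x , v) → x ∷ v) (λ { (x ∷ v) → refl })
  (E ⊗ encodeVec E K)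

encodePow2 : ∀ L → Encoding (Fin (2 ^ L)) L
encodePow2 zero    = record { encode = λ _ → [] ; decode = λ _ → Fin.zero ; decode-encode = λ { Fin.zero → refl } }
encodePow2 (suc L) = retract (remQuot {2} (2 ^ L)) (uncurry combine) (FinP.combine-remQuot {2} (2 ^ L))
  (retract toPM fromPM fromPM-toPM encodePM ⊗ encodePow2 L)
  where
  toPM : Fin 2 → PM
  toPM Fin.zero    = pos
  toPM (Fin.suc _) = neg
  fromPM : PM → Fin 2
  fromPM pos = Fin.zero
  fromPM neg = Fin.suc Fin.zero
  fromPM-toPM : ∀ b → fromPM (toPM b) ≡ b
  fromPM-toPM Fin.zero             = refl
  fromPM-toPM (Fin.suc Fin.zero)   = refl

-- A nonempty Fin k with k ≤ 2 ^ L embeds into Fin (2 ^ L); decoding clamps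
-- out-of-range codes to a default element.
encodeFin : ∀ {k L} → 0 < k → k ≤ 2 ^ L → Encoding (Fin k) L
encodeFin {k} {L} 0<k k≤2^L = retract (λ i → inject≤ i k≤2^L) clamp clamp-inject (encodePow2 L)
  where
  clamp : Fin (2 ^ L) → Fin k
  clamp j with toℕ j <? k
  ... | yes j<k = fromℕ< j<k
  ... | no _    = fromℕ< 0<k
  clamp-inject : ∀ i → clamp (inject≤ i k≤2^L) ≡ i
  clamp-inject i with toℕ (inject≤ i k≤2^L) <? k
  ... | yes j<k = FinP.toℕ-injective (trans (FinP.toℕ-fromℕ< j<k) (FinP.toℕ-inject≤ i k≤2^L))
  ... | no j≮k  = contradiction (subst (_< k) (sym (FinP.toℕ-inject≤ i k≤2^L)) (FinP.toℕ<n i)) j≮k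

sendBits : ∀ {X Y : Set} m → (X → Vec PM m) → (Y → Vec PM m → PM) → Protocol X Y (m + 1)
sendBits zero    msg out = bob (λ y → out y []) leaf
sendBits (suc m) msg out =
  alice (Vec.head ∘ msg) (λ b → sendBits m (Vec.tail ∘ msg) (λ y v → out y (b ∷ v)))

run-sendBits : ∀ {X Y : Set} m (msg : X → Vec PM m) (out : Y → Vec PM m → PM) x y →
  run (sendBits m msg out) x y ≡ out y (msg x)
run-sendBits zero    msg out x y with msg x
... | [] = refl
run-sendBits (suc m) msg out x y =
  trans (run-sendBits m (Vec.tail ∘ msg) (λ y v → out y (Vec.head (msg x) ∷ v)) x y)
        (cong (out y) (head∷tail (msg x)))
  where
  head∷tail : ∀ {n} (v : Vec PM (suc n)) → Vec.head v ∷ Vec.tail v ≡ v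
  head∷tail (b ∷ v) = refl

oneWay : ∀ {X Y M : Set} {m} → Encoding M m → (X → M) → (Y → M → PM) → Protocol X Y (m + 1)
oneWay {m = m} E msg out = sendBits m (encode E ∘ msg) (λ y v → out y (decode E v))

run-oneWay : ∀ {X Y M : Set} {m} (E : Encoding M m) (msg : X → M) (out : Y → M → PM) x y →
  run (oneWay E msg out) x y ≡ out y (msg x)
run-oneWay {m = m} E msg out x y =
  trans (run-sendBits m (encode E ∘ msg) (λ y v → out y (decode E v)) x y)
        (cong (out y) (decode-encode E (msg x)))

-- A ±1-valued outcome g over S equally likely random
-- strings agrees with T on (S + val T · Σ g) / 2 strings; if Σ g has the sign
-- of T, this exceeds S / 2, giving bias at least 1 / S ≥ 1 / 2 ^ t.

sumFin-cong : ∀ {m} {g h : Fin m → ℕ} → (∀ i → g i ≡ h i) → sumFin g ≡ sumFin h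
sumFin-cong {zero}  e = refl
sumFin-cong {suc m} e = cong₂ _+_ (e Fin.zero) (sumFin-cong (e ∘ Fin.suc))

agreements : ∀ {S} (g : Fin S → PM) T →
  + (2 * sumFin (λ r → pmEq (g r) T)) ≡ + S ℤ.+ val T ℤ.* sum (val ∘ g)
agreements {zero}  g T = sym (trans (ℤP.+-identityˡ _) (ℤP.*-zeroʳ (val T)))
agreements {suc S} g T = begin
  + (2 * (pmEq (g Fin.zero) T + A))
    ≡⟨ cong +_ (ℕP.*-distribˡ-+ 2 (pmEq (g Fin.zero) T) A) ⟩
  + (2 * pmEq (g Fin.zero) T) ℤ.+ + (2 * A)
    ≡⟨ cong₂ ℤ._+_ (agree₁ (g Fin.zero) T) (agreements (g ∘ Fin.suc) T) ⟩
  (+ 1 ℤ.+ val T ℤ.* val (g Fin.zero)) ℤ.+ (+ S ℤ.+ val T ℤ.* sum (val ∘ g ∘ Fin.suc))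
    ≡⟨ regroup (val T) (val (g Fin.zero)) (+ S) (sum (val ∘ g ∘ Fin.suc)) ⟩
  + suc S ℤ.+ val T ℤ.* sum (val ∘ g) ∎
  where
  open ≡-Reasoning
  A = sumFin (λ r → pmEq (g (Fin.suc r)) T)
  agree₁ : ∀ u T → + (2 * pmEq u T) ≡ + 1 ℤ.+ val T ℤ.* val u
  agree₁ pos pos = refl
  agree₁ pos neg = refl
  agree₁ neg pos = refl
  agree₁ neg neg = refl
  regroup : ∀ t u M Σg → (+ 1 ℤ.+ t ℤ.* u) ℤ.+ (M ℤ.+ t ℤ.* Σg) ≡ (+ 1 ℤ.+ M) ℤ.+ t ℤ.* (u ℤ.+ Σg)
  regroup = solve-∀

bias-from-sign : ∀ {S t} (g : Fin S → PM) T → HasSign T (sum (val ∘ g)) → 2 * S ≤ 2 ^ t →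
  (2 ^ t + 2) * S ≤ 2 ^ suc t * sumFin (λ r → pmEq (g r) T)
bias-from-sign {S} {t} g T (hasSign k signed) 2S≤2^t = begin
  (2 ^ t + 2) * S             ≡⟨ ℕP.*-distribʳ-+ S (2 ^ t) 2 ⟩
  2 ^ t * S + 2 * S           ≤⟨ ℕP.+-monoʳ-≤ (2 ^ t * S) (ℕP.≤-trans 2S≤2^t (ℕP.m≤m*n (2 ^ t) (suc k))) ⟩
  2 ^ t * S + 2 ^ t * suc k   ≡⟨ ℕP.*-distribˡ-+ (2 ^ t) S (suc k) ⟨
  2 ^ t * (S + suc k)         ≡⟨ cong (2 ^ t *_) (ℤP.+-injective twiceAgree) ⟨
  2 ^ t * (2 * NC)            ≡⟨ swap (2 ^ t) NC ⟩
  2 ^ suc t * NC              ∎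
  where
  open ℕP.≤-Reasoning
  NC = sumFin (λ r → pmEq (g r) T)
  swap : ∀ a b → a * (2 * b) ≡ 2 * a * b
  swap = ℕSolver.solve-∀
  twiceAgree : + (2 * NC) ≡ + (S + suc k)
  twiceAgree = trans (agreements g T) (cong (λ u → + S ℤ.+ u) signed)

⌈log₂⌉-pos : ∀ n → 2 ≤ n → 1 ≤ ⌈log₂ n ⌉
⌈log₂⌉-pos n 2≤n = subst (_≤ ⌈log₂ n ⌉) (⌈log₂2^n⌉≡n 1) (⌈log₂⌉-mono-≤ 2≤n)

n≤2^⌈log₂n⌉ : ∀ n → n ≤ 2 ^ ⌈log₂ n ⌉
n≤2^⌈log₂n⌉ = <-rec (λ n → n ≤ 2 ^ ⌈log₂ n ⌉) step
  where
  step : ∀ n → (∀ {m} → m < n → m ≤ 2 ^ ⌈log₂ m ⌉) → n ≤ 2 ^ ⌈log₂ n ⌉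
  step zero          _  = z≤n
  step (suc zero)    _  = s≤s z≤n
  step (suc (suc m)) ih = begin
    2 + m                            ≡⟨ ℕP.⌊n/2⌋+⌈n/2⌉≡n (2 + m) ⟨
    ⌊ 2 + m /2⌋ + h                  ≤⟨ ℕP.+-monoˡ-≤ h (ℕP.⌊n/2⌋≤⌈n/2⌉ (2 + m)) ⟩
    h + h                            ≤⟨ ℕP.+-mono-≤ ih-h ih-h ⟩
    2 ^ ⌈log₂ h ⌉ + 2 ^ ⌈log₂ h ⌉    ≡⟨ cong (λ u → 2 ^ ⌈log₂ h ⌉ + u) (ℕP.+-identityʳ _) ⟨
    2 ^ suc ⌈log₂ h ⌉                ≡⟨ cong (2 ^_) halve ⟩
    2 ^ ⌈log₂ 2 + m ⌉                ∎
    where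
    open ℕP.≤-Reasoning
    h = ⌈ 2 + m /2⌉
    ih-h = ih (ℕP.⌈n/2⌉<n m)
    halve : suc ⌈log₂ h ⌉ ≡ ⌈log₂ 2 + m ⌉
    halve = trans (cong suc (⌈log₂⌈n/2⌉⌉≡⌈log₂n⌉∸1 (2 + m)))
                  (ℕP.m+[n∸m]≡n (⌈log₂⌉-pos (2 + m) (s≤s (s≤s z≤n))))

cost-bound : ∀ k L → 1 ≤ L → ((1 + k * (suc L + 1)) + 1) + suc (suc L * k) ≤ 6 * (k + 1) * L
cost-bound k (suc L) _ = subst (lhs ≤_) (identity k L) (ℕP.m≤m+n lhs (4 * k * L + k + 6 * L + 3))
  where
  lhs = ((1 + k * (suc (suc L) + 1)) + 1) + suc (suc (suc L) * k)
  identity : ∀ k L → ((1 + k * (suc (suc L) + 1)) + 1) + suc (suc (suc L) * k) + (4 * k * L + k + 6 * L + 3)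
                     ≡ 6 * (k + 1) * suc L
  identity = ℕSolver.solve-∀

-- With z = x · y
-- and d = |z| (so f z = D f d), Alice sends the parity of x, from which Bob
-- learns psign d, and for each root i of D f below n - 1 one independent sample
-- of the estimator for i, named in ⌈log₂ n ⌉ + 1 bits plus her bit at the
-- sampled coordinate.  Bob outputs D f (base (psign d)) times the product of
-- the estimates; by telescoping, its expectation has the sign of f z.

module XorProtocol (n : ℕ) (2≤n : 2 ≤ n) (f : (Fin n → PM) → PM) (symmetric : Symmetric f) where

  open Telescope (D f)
  open Estimator n

  Input : Set
  Input = Fin n → PM

  L : ℕ
  L = ⌈log₂ n ⌉

  R : List ℕ
  R = roots (n ∸ 1)

  K : ℕ
  K = length R

  -- A slot message: the sample ω and Alice's bit at the coordinate it reads.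
  Slot : Set
  Slot = Fin (n + n) × PM

  -- Alice reveals her coordinate when the sample reads z r = x r · y r.
  aliceBit : Input → Fin n ⊎ Fin n → PM
  aliceBit x (inj₁ r) = x r
  aliceBit x (inj₂ r) = pos

  bobBit : ℕ → Input → PM → Fin n ⊎ Fin n → PM
  bobBit i y b (inj₁ r) = b · y r
  bobBit i y b (inj₂ r) = neg · stdInput n (suc i) r

  slotMsg : Input → Fin (n + n) → Slot
  slotMsg x ω = ω , aliceBit x (splitAt n ω)

  slotOut : ℕ → PM → Input → Slot → PM
  slotOut i P y (ω , b) = whenEq (psign i) P (bobBit i y b (splitAt n ω))

  slot-correct : ∀ i P x y ω → slotOut i P y (slotMsg x ω) ≡ estimate i P (λ r → x r · y r) ω
  slot-correct i P x y ω = cong (whenEq (psign i) P) (reads (splitAt n ω))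
    where
    reads : ∀ s → bobBit i y (aliceBit x s) s ≡ rawSample i (λ r → x r · y r) s
    reads (inj₁ r) = refl
    reads (inj₂ r) = refl

  slotsMsg : (R : List ℕ) → Input → Fin ((n + n) ^ length R) → Vec Slot (length R)
  slotsMsg []      x ω = []
  slotsMsg (i ∷ R) x ω = slotMsg x (proj₁ q) ∷ slotsMsg R x (proj₂ q)
    where q = remQuot {n + n} ((n + n) ^ length R) ω

  slotsOut : (R : List ℕ) → PM → Input → Vec Slot (length R) → PM
  slotsOut []      P y []      = pos
  slotsOut (i ∷ R) P y (s ∷ v) = slotOut i P y s · slotsOut R P y v

  slots-correct : ∀ R P x y ω →
    slotsOut R P y (slotsMsg R x ω) ≡ sampleAll R (λ i → estimate i P (λ r → x r · y r)) ω
  slots-correct []      P x y ω = refl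
  slots-correct (i ∷ R) P x y ω = cong₂ _·_ (slot-correct i P x y _) (slots-correct R P x y _)

  n+n≤2^[1+L] : n + n ≤ 2 ^ suc L
  n+n≤2^[1+L] = ℕP.+-mono-≤ (n≤2^⌈log₂n⌉ n) (subst (n ≤_) (sym (ℕP.+-identityʳ (2 ^ L))) (n≤2^⌈log₂n⌉ n))

  0<n+n : 0 < n + n
  0<n+n = ℕP.<-≤-trans (s≤s z≤n) (ℕP.≤-trans 2≤n (ℕP.m≤m+n n n))

  message : Encoding (PM × Vec Slot K) (1 + K * (suc L + 1))
  message = encodePM ⊗ encodeVec (encodeFin 0<n+n n+n≤2^[1+L] ⊗ encodePM) K

  S : ℕ
  S = (n + n) ^ K

  instance
    S-nonZero : NonZero S
    S-nonZero = ℕP.m^n≢0 (n + n) K {{>-nonZero 0<n+n}}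

  samples : Fin (suc (pred S)) → Fin S
  samples = subst Fin (ℕP.suc-pred S)

  aliceMsg : Input × Fin (suc (pred S)) → PM × Vec Slot K
  aliceMsg (x , ρ) = prodPM x , slotsMsg R x (samples ρ)

  bobOut : Input × Fin 1 → PM × Vec Slot K → PM
  bobOut (y , _) (p , v) = D f (base P) · slotsOut R P y v
    where P = p · prodPM y

  cost : ℕ
  cost = (1 + K * (suc L + 1)) + 1

  protocol : RandProtocol Input Input cost
  protocol = record { a = pred S ; b = 0 ; tree = oneWay message aliceMsg bobOut }

  run-protocol : ∀ x y ρ ρ' → let z = λ r → x r · y r ; P = psign (countNeg z) in
    run (tree protocol) (x , ρ) (y , ρ') ≡ D f (base P) · sampleAll R (λ i → estimate i P z) (samples ρ)
  run-protocol x y ρ ρ' =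
    trans (run-oneWay message aliceMsg bobOut (x , ρ) (y , ρ'))
      (trans (cong (λ P → D f (base P) · slotsOut R P y (slotsMsg R x (samples ρ))) parity)
             (cong (D f (base (psign (countNeg z))) ·_) (slots-correct R _ x y (samples ρ))))
    where
    z = λ r → x r · y r
    parity : prodPM x · prodPM y ≡ psign (countNeg z)
    parity = trans (sym (prodPM-· x y)) (prodPM-countNeg z)

  outcome-sign : ∀ x y → let z = λ r → x r · y r in
    HasSign (f z) (sum (λ ρ → val (run (tree protocol) (x , ρ) (y , Fin.zero))))
  outcome-sign x y = subst (HasSign (f z)) (sym signedSum) (HasSign-factor (HasSign-resign settled estimatesSign))
    where
    z = λ r → x r · y r
    d = countNeg z
    P = psign d
    Db = D f (base P)
    joint : Fin S → PM
    joint = sampleAll R (λ i → estimate i P z)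
    estimates : ℕ → ℤ
    estimates i = sum (val ∘ estimate i P z)
    estimatesSign : HasSign (telescope (n ∸ 1) d) (prodℤ R estimates)
    estimatesSign = roots-sign (n ∸ 1) d estimates
      (λ i i<n-1 → estimate-sign i z (ℕP.≤-trans i<n-1 (ℕP.m∸n≤m n 1)))
    fz : f z ≡ D f d
    fz = symmetric z (stdInput n d) (sym (countNeg-stdInput n d (countNeg≤ z)))
    settled : telescope (n ∸ 1) d ≡ f z · Db
    settled = trans (telescope-settled (n ∸ 1) d (ℕP.≤-trans (countNeg≤ z) (ℕP.m≤n+m∸n n 1)))
                    (cong (_· Db) (sym fz))
    signedSum : sum (λ ρ → val (run (tree protocol) (x , ρ) (y , Fin.zero))) ≡ val Db ℤ.* prodℤ R estimates
    signedSum = begin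
      sum (λ ρ → val (run (tree protocol) (x , ρ) (y , Fin.zero)))
        ≡⟨ sum-cong-≗ (λ ρ → trans (cong val (run-protocol x y ρ Fin.zero)) (val-· Db (joint (samples ρ)))) ⟩
      sum (λ ρ → val Db ℤ.* val (joint (samples ρ)))
        ≡⟨ *-distribˡ-sum (val Db) (val ∘ joint ∘ samples) ⟨
      val Db ℤ.* sum (val ∘ joint ∘ samples)
        ≡⟨ cong (val Db ℤ.*_) (sum-subst (ℕP.suc-pred S) (val ∘ joint)) ⟩
      val Db ℤ.* sum (val ∘ joint)
        ≡⟨ cong (val Db ℤ.*_) (sum-sampleAll R (λ i → estimate i P z)) ⟩
      val Db ℤ.* prodℤ R estimates ∎
      where open ≡-Reasoning

  -- The protocol has bias at least 1 / S ≥ 1 / 2 ^ t for t = 1 + (L + 1) K.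
  t : ℕ
  t = suc (suc L * K)

  2S≤2^t : 2 * suc (pred S) ≤ 2 ^ t
  2S≤2^t = ℕP.*-monoʳ-≤ 2 (begin
    suc (pred S)        ≡⟨ ℕP.suc-pred S ⟩
    (n + n) ^ K         ≤⟨ ℕP.^-monoˡ-≤ K n+n≤2^[1+L] ⟩
    (2 ^ suc L) ^ K     ≡⟨ ℕP.^-*-assoc 2 (suc L) K ⟩
    2 ^ (suc L * K)     ∎)
    where open ℕP.≤-Reasoning

  correct : CorrectWithBias protocol (f ∘XOR) t
  correct x y = subst₂ _≤_ (cong ((2 ^ t + 2) *_) (sym (ℕP.*-identityʳ (suc (pred S)))))
                           (cong (2 ^ suc t *_) (sym agreeing))
    (bias-from-sign {t = t} outcome (f z) (outcome-sign x y) 2S≤2^t)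
    where
    z = λ r → x r · y r
    outcome : Fin (suc (pred S)) → PM
    outcome ρ = run (tree protocol) (x , ρ) (y , Fin.zero)
    agreeing : numCorrect protocol (f ∘XOR) x y ≡ sumFin (λ ρ → pmEq (outcome ρ) (f z))
    agreeing = sumFin-cong (λ ρ → ℕP.+-identityʳ (pmEq (outcome ρ) (f z)))

  pp-bound : PPAtMost (f ∘XOR) (6 * (K + 1) * L)
  pp-bound = cost , t , cost-bound K L (⌈log₂⌉-pos n 2≤n) , protocol , correct

-- Theorem 10.
mainTheorem10 : ∃ λ (C : ℕ) → ∀ (n : ℕ) → 2 ∣ n → 2 ≤ n →
    ∀ (f : (Fin n → PM) → PM) → Symmetric f →
    ∀ (k : ℕ) → oddEvenDeg f ≡ k →
    PPAtMost (f ∘XOR) (C * (k + 1) * ⌈log₂ n ⌉)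
mainTheorem10 = 6 , λ n _ 2≤n f symmetric k degree≡k →
  subst (λ k → PPAtMost (f ∘XOR) (6 * (k + 1) * ⌈log₂ n ⌉))
        (trans (Telescope.length-roots (D f) (n ∸ 1)) degree≡k)
        (XorProtocol.pp-bound n 2≤n f symmetric)
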